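{- For every positive logic $P$, $P=(\mathrm{Int}+P)^+$.
   Context: Formulas are built from a countable set of propositional variables using $\land,\lor,\to$ and the constant $\bot$. Positive formulas are those not containing $\bot$; $\mathrm{Frm}^+$ is the set of positive formulas. $\mathrm{Int}$ is the set of theorems of intuitionistic propositional logic and $\mathrm{Int}^+=\mathrm{Int}\cap\mathrm{Frm}^+$. A superintuitionistic (si-)logic is a set of formulas containing $\mathrm{Int}$ and closed under modus ponens and substitutions. A positive logic is a set of positive formulas containing $\mathrm{Int}^+$ and closed under modus ponens and positive substitutions. For an si-logic $L$, $L^+=L\cap\mathrm{Frm}^+$. $\mathrm{Int}+P$ is the least si-logic containing $\mathrm{Int}\cup P$. -}

module Defs where

open import Data.Nat using (ℕ)
open import Data.Product using (_×_)
open import Function.Bundles using (_⇔_)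

infixr 6 _∧'_
infixr 5 _∨'_
infixr 4 _⇒_

data Frm : Set where
  var  : ℕ → Frm
  ⊥'   : Frm
  _∧'_ : Frm → Frm → Frm
  _∨'_ : Frm → Frm → Frm
  _⇒_  : Frm → Frm → Frm

data Positive : Frm → Set where
  pvar : ∀ n → Positive (var n)
  p∧ : ∀ {A B} → Positive A → Positive B → Positive (A ∧' B)
  p∨ : ∀ {A B} → Positive A → Positive B → Positive (A ∨' B)
  p⇒ : ∀ {A B} → Positive A → Positive B → Positive (A ⇒ B)

Subst : Set
Subst = ℕ → Frm

_[_] : Frm → Subst → Frm
var n [ σ ] = σ n
⊥' [ σ ] = ⊥'
(A ∧' B) [ σ ] = (A [ σ ]) ∧' (B [ σ ])
(A ∨' B) [ σ ] = (A [ σ ]) ∨' (B [ σ ])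
(A ⇒ B) [ σ ] = (A [ σ ]) ⇒ (B [ σ ])

PositiveSubst : Subst → Set
PositiveSubst σ = ∀ n → Positive (σ n)

data Int : Frm → Set where
  k   : ∀ A B → Int (A ⇒ B ⇒ A)
  s   : ∀ A B C → Int ((A ⇒ B ⇒ C) ⇒ (A ⇒ B) ⇒ A ⇒ C)
  ∧e₁ : ∀ A B → Int (A ∧' B ⇒ A)
  ∧e₂ : ∀ A B → Int (A ∧' B ⇒ B)
  ∧i  : ∀ A B → Int (A ⇒ B ⇒ A ∧' B)
  ∨i₁ : ∀ A B → Int (A ⇒ A ∨' B)
  ∨i₂ : ∀ A B → Int (B ⇒ A ∨' B)
  ∨e  : ∀ A B C → Int ((A ⇒ C) ⇒ (B ⇒ C) ⇒ (A ∨' B ⇒ C))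
  efq : ∀ A → Int (⊥' ⇒ A)
  mp  : ∀ {A B} → Int (A ⇒ B) → Int A → Int B

IntPos : Frm → Set
IntPos A = Int A × Positive A

data IntPlus (P : Frm → Set) : Frm → Set where
  int  : ∀ {A} → Int A → IntPlus P A
  hyp  : ∀ {A} → P A → IntPlus P A
  mp   : ∀ {A B} → IntPlus P (A ⇒ B) → IntPlus P A → IntPlus P B
  sub  : ∀ {A} (σ : Subst) → IntPlus P A → IntPlus P (A [ σ ])

_⁺ : (Frm → Set) → Frm → Set
(L ⁺) A = L A × Positive A

record IsPositiveLogic (P : Frm → Set) : Set where
  field
    positive : ∀ {A} → P A → Positive A
    intPos   : ∀ {A} → IntPos A → P A
    closedMP : ∀ {A B} → P (A ⇒ B) → P A → P B
    closedSub : ∀ {A} (σ : Subst) → PositiveSubst σ → P A → P (A [ σ ])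

_≐_ : (Frm → Set) → (Frm → Set) → Set
P ≐ Q = ∀ A → P A ⇔ Q A

module Submission where

-- P ⊆ (Int + P)⁺ is immediate.  For the converse we interpret
-- Int + P inside P by a ⊥-translation: for a positive substitution ρ and a
-- positive formula c, let ⟦A⟧ρc be A with ⊥ replaced by c and every variable
-- n replaced by ρ n.  If P ⊢ c → ρ n for all n, then ⟦B⟧ρc ∈ P for every
-- B ∈ Int + P (induction on the derivation of B):
--   * Int-axioms translate to positive Int-theorems, except ex falso, whose
--     translation c → ⟦A⟧ρc holds since c implies every translated formula;
--   * P-members are positive, so their translation is a positive substitution
--     instance;
--   * translating a substitution instance B[σ] is translating B along the
--     composite ρ' n = ⟦σ n⟧ρc, and c still implies every ρ' n.
-- Finally, for a positive A with variables among 0 … m-1, take c the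
-- conjunction of these variables and ρ the identity below m and c above:
-- then ⟦A⟧ρc = A, so A ∈ P.

open import Defs
open import Data.Nat using (ℕ; zero; suc; _<_; _⊔_; _<?_)
open import Data.Nat.Properties using (m≤m⊔n; m≤n⊔m; <-≤-trans; m<1+n⇒m<n∨m≡n; ≤-refl)
open import Data.Product using (_,_)
open import Data.Sum using (inj₁; inj₂)
open import Data.Empty using (⊥-elim)
open import Data.List using (List; []; _∷_)
open import Data.List.Membership.Propositional using (_∈_)
open import Data.List.Relation.Unary.Any using (here; there)
open import Function.Bundles using (mk⇔)
open import Relation.Nullary using (yes; no)
open import Relation.Binary.PropositionalEquality using (_≡_; refl; cong₂; subst; sym; trans)

data _⊢_ (Γ : List Frm) : Frm → Set where
  ax  : ∀ {A} → Int A → Γ ⊢ A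
  as  : ∀ {A} → A ∈ Γ → Γ ⊢ A
  dmp : ∀ {A B} → Γ ⊢ (A ⇒ B) → Γ ⊢ A → Γ ⊢ B

closed : ∀ {A} → [] ⊢ A → Int A
closed (ax i)    = i
closed (as ())
closed (dmp f x) = mp (closed f) (closed x)

identity : ∀ A → Int (A ⇒ A)
identity A = mp (mp (s A (A ⇒ A) A) (k A (A ⇒ A))) (k A A)

deduction : ∀ {Γ A B} → (A ∷ Γ) ⊢ B → Γ ⊢ (A ⇒ B)
deduction {A = A} {B} (ax i)         = dmp (ax (k B A)) (ax i)
deduction {A = A} (as (here refl))   = ax (identity A)
deduction {A = A} {B} (as (there p)) = dmp (ax (k B A)) (as p)
deduction {A = A} {B} (dmp {C} f x)  = dmp (dmp (ax (s A C B)) (deduction f)) (deduction x)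

#0 : ∀ {A Γ} → (A ∷ Γ) ⊢ A
#0 = as (here refl)

#1 : ∀ {A B Γ} → (B ∷ A ∷ Γ) ⊢ A
#1 = as (there (here refl))

#2 : ∀ {A B C Γ} → (C ∷ B ∷ A ∷ Γ) ⊢ A
#2 = as (there (there (here refl)))

compose : ∀ {A B C} → Int (A ⇒ B) → Int (B ⇒ C) → Int (A ⇒ C)
compose f g = closed (deduction (dmp (ax g) (dmp (ax f) #0)))

∧-under : ∀ C A B → Int ((C ⇒ A) ⇒ (C ⇒ B) ⇒ C ⇒ A ∧' B)
∧-under C A B =
  closed (deduction (deduction (deduction (dmp (dmp (ax (∧i A B)) (dmp #2 #0)) (dmp #1 #0)))))

∨-under : ∀ C A B → Int ((C ⇒ A) ⇒ C ⇒ A ∨' B)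
∨-under C A B = closed (deduction (deduction (dmp (ax (∨i₁ A B)) (dmp #1 #0))))

⇒-under : ∀ C A B → Int ((C ⇒ B) ⇒ C ⇒ A ⇒ B)
⇒-under C A B = closed (deduction (deduction (deduction (dmp #2 #1))))

⟦_⟧ : Frm → Subst → Frm → Frm
⟦ var n  ⟧ ρ c = ρ n
⟦ ⊥'     ⟧ ρ c = c
⟦ A ∧' B ⟧ ρ c = ⟦ A ⟧ ρ c ∧' ⟦ B ⟧ ρ c
⟦ A ∨' B ⟧ ρ c = ⟦ A ⟧ ρ c ∨' ⟦ B ⟧ ρ c
⟦ A ⇒ B  ⟧ ρ c = ⟦ A ⟧ ρ c ⇒ ⟦ B ⟧ ρ c

⟦⟧-positive : ∀ {ρ c} → PositiveSubst ρ → Positive c → ∀ A → Positive (⟦ A ⟧ ρ c)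
⟦⟧-positive pρ pc (var n)  = pρ n
⟦⟧-positive pρ pc ⊥'       = pc
⟦⟧-positive pρ pc (A ∧' B) = p∧ (⟦⟧-positive pρ pc A) (⟦⟧-positive pρ pc B)
⟦⟧-positive pρ pc (A ∨' B) = p∨ (⟦⟧-positive pρ pc A) (⟦⟧-positive pρ pc B)
⟦⟧-positive pρ pc (A ⇒ B)  = p⇒ (⟦⟧-positive pρ pc A) (⟦⟧-positive pρ pc B)

⟦⟧-of-positive : ∀ ρ c {A} → Positive A → ⟦ A ⟧ ρ c ≡ A [ ρ ]
⟦⟧-of-positive ρ c (pvar n)  = refl
⟦⟧-of-positive ρ c (p∧ a b) = cong₂ _∧'_ (⟦⟧-of-positive ρ c a) (⟦⟧-of-positive ρ c b)
⟦⟧-of-positive ρ c (p∨ a b) = cong₂ _∨'_ (⟦⟧-of-positive ρ c a) (⟦⟧-of-positive ρ c b)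
⟦⟧-of-positive ρ c (p⇒ a b) = cong₂ _⇒_ (⟦⟧-of-positive ρ c a) (⟦⟧-of-positive ρ c b)

⟦⟧-of-subst : ∀ ρ c σ A → ⟦ A [ σ ] ⟧ ρ c ≡ ⟦ A ⟧ (λ n → ⟦ σ n ⟧ ρ c) c
⟦⟧-of-subst ρ c σ (var n)  = refl
⟦⟧-of-subst ρ c σ ⊥'       = refl
⟦⟧-of-subst ρ c σ (A ∧' B) = cong₂ _∧'_ (⟦⟧-of-subst ρ c σ A) (⟦⟧-of-subst ρ c σ B)
⟦⟧-of-subst ρ c σ (A ∨' B) = cong₂ _∨'_ (⟦⟧-of-subst ρ c σ A) (⟦⟧-of-subst ρ c σ B)
⟦⟧-of-subst ρ c σ (A ⇒ B)  = cong₂ _⇒_ (⟦⟧-of-subst ρ c σ A) (⟦⟧-of-subst ρ c σ B)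

bound : Frm → ℕ
bound (var n)  = suc n
bound ⊥'       = 0
bound (A ∧' B) = bound A ⊔ bound B
bound (A ∨' B) = bound A ⊔ bound B
bound (A ⇒ B)  = bound A ⊔ bound B

below-⊔ˡ : ∀ {Q : ℕ → Set} a b → (∀ n → n < a ⊔ b → Q n) → ∀ n → n < a → Q n
below-⊔ˡ a b q n l = q n (<-≤-trans l (m≤m⊔n a b))

below-⊔ʳ : ∀ {Q : ℕ → Set} a b → (∀ n → n < a ⊔ b → Q n) → ∀ n → n < b → Q n
below-⊔ʳ a b q n l = q n (<-≤-trans l (m≤n⊔m a b))

subst-fixes : ∀ ρ A → (∀ n → n < bound A → ρ n ≡ var n) → A [ ρ ] ≡ A
subst-fixes ρ (var n)  fix = fix n ≤-refl
subst-fixes ρ ⊥'       fix = refl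
subst-fixes ρ (A ∧' B) fix =
  cong₂ _∧'_ (subst-fixes ρ A (below-⊔ˡ (bound A) (bound B) fix))
             (subst-fixes ρ B (below-⊔ʳ (bound A) (bound B) fix))
subst-fixes ρ (A ∨' B) fix =
  cong₂ _∨'_ (subst-fixes ρ A (below-⊔ˡ (bound A) (bound B) fix))
             (subst-fixes ρ B (below-⊔ʳ (bound A) (bound B) fix))
subst-fixes ρ (A ⇒ B)  fix =
  cong₂ _⇒_ (subst-fixes ρ A (below-⊔ˡ (bound A) (bound B) fix))
            (subst-fixes ρ B (below-⊔ʳ (bound A) (bound B) fix))

conj : ℕ → Frm
conj zero    = var 0
conj (suc m) = var m ∧' conj m

conj-positive : ∀ m → Positive (conj m)
conj-positive zero    = pvar 0
conj-positive (suc m) = p∧ (pvar m) (conj-positive m)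

conj⇒var : ∀ m n → n < m → Int (conj m ⇒ var n)
conj⇒var (suc m) n l with m<1+n⇒m<n∨m≡n l
... | inj₂ refl = ∧e₁ (var m) (conj m)
... | inj₁ n<m  = compose (∧e₂ (var m) (conj m)) (conj⇒var m n n<m)

truncate : ℕ → Subst
truncate m n with n <? m
... | yes _ = var n
... | no  _ = conj m

truncate-positive : ∀ m → PositiveSubst (truncate m)
truncate-positive m n with n <? m
... | yes _ = pvar n
... | no  _ = conj-positive m

truncate-fixes : ∀ m n → n < m → truncate m n ≡ var n
truncate-fixes m n l with n <? m
... | yes _ = refl
... | no n≮m = ⊥-elim (n≮m l)

conj⇒truncate : ∀ m n → Int (conj m ⇒ truncate m n)
conj⇒truncate m n with n <? m
... | yes l = conj⇒var m n l
... | no  _ = identity (conj m)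

module _ (P : Frm → Set) (L : IsPositiveLogic P) where
  open IsPositiveLogic L

  -- Parameters for which the translation of Int + P lands in P.
  record Admissible : Set where
    field
      ρ       : Subst
      c       : Frm
      ρ-pos   : PositiveSubst ρ
      c-pos   : Positive c
      c⇒ρ     : ∀ n → P (c ⇒ ρ n)

  module Translation (τ : Admissible) where
    open Admissible τ

    tr : Frm → Frm
    tr A = ⟦ A ⟧ ρ c

    int-in-P : ∀ X → Int (tr X) → P (tr X)
    int-in-P X i = intPos (i , ⟦⟧-positive ρ-pos c-pos X)

    -- c implies the translation of every formula (this replaces ex falso).
    c⇒tr : ∀ X → P (c ⇒ tr X)
    c⇒tr (var n)  = c⇒ρ n
    c⇒tr ⊥'       = int-in-P (⊥' ⇒ ⊥') (identity c)
    c⇒tr (A ∧' B) =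
      closedMP (closedMP (int-in-P ((⊥' ⇒ A) ⇒ (⊥' ⇒ B) ⇒ ⊥' ⇒ A ∧' B) (∧-under c (tr A) (tr B)))
                         (c⇒tr A))
               (c⇒tr B)
    c⇒tr (A ∨' B) = closedMP (int-in-P ((⊥' ⇒ A) ⇒ ⊥' ⇒ A ∨' B) (∨-under c (tr A) (tr B))) (c⇒tr A)
    c⇒tr (A ⇒ B)  = closedMP (int-in-P ((⊥' ⇒ B) ⇒ ⊥' ⇒ A ⇒ B) (⇒-under c (tr A) (tr B))) (c⇒tr B)

    -- Translations of Int-theorems are in P: every axiom but ex falso
    -- translates to an instance of itself.
    int-tr : ∀ {B} → Int B → P (tr B)
    int-tr (k A B)     = int-in-P (A ⇒ B ⇒ A) (k _ _)
    int-tr (s A B C)   = int-in-P ((A ⇒ B ⇒ C) ⇒ (A ⇒ B) ⇒ A ⇒ C) (s _ _ _)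
    int-tr (∧e₁ A B)   = int-in-P (A ∧' B ⇒ A) (∧e₁ _ _)
    int-tr (∧e₂ A B)   = int-in-P (A ∧' B ⇒ B) (∧e₂ _ _)
    int-tr (∧i A B)    = int-in-P (A ⇒ B ⇒ A ∧' B) (∧i _ _)
    int-tr (∨i₁ A B)   = int-in-P (A ⇒ A ∨' B) (∨i₁ _ _)
    int-tr (∨i₂ A B)   = int-in-P (B ⇒ A ∨' B) (∨i₂ _ _)
    int-tr (∨e A B C)  = int-in-P ((A ⇒ C) ⇒ (B ⇒ C) ⇒ A ∨' B ⇒ C) (∨e _ _ _)
    int-tr (efq A)     = c⇒tr A
    int-tr (mp f x)    = closedMP (int-tr f) (int-tr x)

    after : Subst → Admissible
    after σ = record
      { ρ     = λ n → tr (σ n)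
      ; c     = c
      ; ρ-pos = λ n → ⟦⟧-positive ρ-pos c-pos (σ n)
      ; c-pos = c-pos
      ; c⇒ρ   = λ n → c⇒tr (σ n)
      }

  translate-in-P : ∀ {B} → IntPlus P B → (τ : Admissible) → P (Translation.tr τ B)
  translate-in-P (int i)  τ = Translation.int-tr τ i
  translate-in-P (hyp p)  τ =
    subst P (sym (⟦⟧-of-positive ρ c (positive p))) (closedSub ρ ρ-pos p)
    where open Admissible τ
  translate-in-P (mp f x) τ = closedMP (translate-in-P f τ) (translate-in-P x τ)
  translate-in-P (sub {B} σ d) τ =
    subst P (sym (⟦⟧-of-subst ρ c σ B)) (translate-in-P d (Translation.after τ σ))
    where open Admissible τ

  truncation : ℕ → Admissible
  truncation m = record
    { ρ     = truncate m
    ; c     = conj m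
    ; ρ-pos = truncate-positive m
    ; c-pos = conj-positive m
    ; c⇒ρ   = λ n → intPos (conj⇒truncate m n , p⇒ (conj-positive m) (truncate-positive m n))
    }

  -- Conservativity: a positive theorem of Int + P is in P, since its
  -- translation under truncation at its bound is itself.
  conservative : ∀ {A} → IntPlus P A → Positive A → P A
  conservative {A} d pA = subst P translation-is-A (translate-in-P d (truncation m))
    where
    m = bound A
    translation-is-A : ⟦ A ⟧ (truncate m) (conj m) ≡ A
    translation-is-A = trans (⟦⟧-of-positive (truncate m) (conj m) pA)
                             (subst-fixes (truncate m) A (truncate-fixes m))

mainTheorem8 : (P : Frm → Set) → IsPositiveLogic P → P ≐ (IntPlus P ⁺)
mainTheorem8 P L A =
  mk⇔ (λ p → hyp p , IsPositiveLogic.positive L p)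
      (λ (d , pA) → conservative P L d pA)
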